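{- For every $n\ge1$, the number of integer sequences $e=(e_1,\dots,e_n)$ with $0\le e_i<i$ for all $i$ having no indices $i<j<k$ with $e_i>e_j\ge e_k$ equals the number of such sequences having no indices $i<j<k$ with $e_j\le e_k$ and $e_i>e_k$. -}

module Defs where

open import Data.Nat using (ℕ; zero; suc; _<_; _≤_; _<?_; _≤?_)
open import Data.Fin using (Fin; toℕ)
open import Data.Fin.Properties using (any?)
open import Data.Vec using (Vec; []; _∷ʳ_; lookup)
open import Data.List using (List; []; _∷_; [_]; map; concatMap; upTo; filter; length)
open import Data.Product using (Σ; _×_; _,_)
open import Relation.Nullary using (¬_; Dec)
open import Relation.Nullary.Decidable using (_×-dec_; ¬?)

-- Built by appending a last entry e_{n+1} ∈ {0,…,n} to each sequence of length n.
-- (Vec positions are 0-based: paper index i is Vec position i-1.)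
invSeqs : (n : ℕ) → List (Vec ℕ n)
invSeqs zero    = [ [] ]
invSeqs (suc n) = concatMap (λ e → map (λ x → e ∷ʳ x) (upTo (suc n))) (invSeqs n)

Pattern₁ : {n : ℕ} → Vec ℕ n → Set
Pattern₁ {n} e = Σ (Fin n) λ i → Σ (Fin n) λ j → Σ (Fin n) λ k →
  (toℕ i < toℕ j) × (toℕ j < toℕ k) × (lookup e j < lookup e i) × (lookup e k ≤ lookup e j)

Pattern₂ : {n : ℕ} → Vec ℕ n → Set
Pattern₂ {n} e = Σ (Fin n) λ i → Σ (Fin n) λ j → Σ (Fin n) λ k →
  (toℕ i < toℕ j) × (toℕ j < toℕ k) × (lookup e j ≤ lookup e k) × (lookup e k < lookup e i)

pattern₁? : {n : ℕ} → (e : Vec ℕ n) → Dec (Pattern₁ e)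
pattern₁? e = any? λ i → any? λ j → any? λ k →
  (toℕ i <? toℕ j) ×-dec (toℕ j <? toℕ k) ×-dec (lookup e j <? lookup e i) ×-dec (lookup e k ≤? lookup e j)

pattern₂? : {n : ℕ} → (e : Vec ℕ n) → Dec (Pattern₂ e)
pattern₂? e = any? λ i → any? λ j → any? λ k →
  (toℕ i <? toℕ j) ×-dec (toℕ j <? toℕ k) ×-dec (lookup e j ≤? lookup e k) ×-dec (lookup e k <? lookup e i)

count₁ : ℕ → ℕ
count₁ n = length (filter (λ e → ¬? (pattern₁? e)) (invSeqs n))

count₂ : ℕ → ℕ
count₂ n = length (filter (λ e → ¬? (pattern₂? e)) (invSeqs n))

-- Both families of pattern-avoiding inversion sequences are generated by appending
-- entries, and they grow along the same generating tree.  Call a value x active for e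
-- if e ∷ʳ x still avoids the pattern, and label e by (M , s), where M = max e and s is
-- the number of active values below M.  Every value ≥ M is active, and appending
-- M + k gives the label (M + k , s + k).  Appending an active y < M keeps the maximum
-- and gives s − 1 − r for the first pattern and r for the second, where r is the
-- number of active values below y; as y runs through the active values below M, both
-- run through 0, …, s − 1.  Hence, level by level, both families have the same
-- multiset of labels, and in particular the same size.
module Submission where

open import Defs
open import Data.Nat using (ℕ; zero; suc; _+_; _∸_; _⊔_; _<_; _≤_; _<?_; _≤?_; z≤n; s≤s⁻¹)
open import Data.Nat.Properties
open import Data.Fin using (Fin; toℕ; inject₁; fromℕ) renaming (zero to fzero; suc to fsuc)
open import Data.Fin.Properties using (toℕ<n; toℕ-inject₁; toℕ-fromℕ; ≤fromℕ; any?)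
open import Data.Fin.Relation.Unary.Top using (view; ‵fromℕ; ‵inject₁)
open import Data.Vec using (Vec; []; _∷_; _∷ʳ_; lookup)
open import Data.List using (List; []; _∷_; [_]; _++_; map; concatMap; filter; length; upTo; downFrom; applyUpTo; reverse)
open import Data.List.Properties
open import Data.List.Relation.Unary.All as All using (All; []; _∷_)
open import Data.List.Relation.Unary.All.Properties using (applyUpTo⁺₁; applyUpTo⁺₂; all-upTo; all-filter; filter⁺; concat⁺)
import Data.List.Relation.Unary.All.Properties as All
open import Data.List.Relation.Binary.Permutation.Propositional using (_↭_; ↭-refl; ↭-reflexive; ↭-trans; prep; swap; module PermutationReasoning)
import Data.List.Relation.Binary.Permutation.Propositional as Perm
open import Data.List.Relation.Binary.Permutation.Propositional.Properties using (++⁺; ++⁺ˡ; shifts; ↭-reverse; ↭-length)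
import Data.List.Relation.Binary.Permutation.Propositional.Properties as Perm
open import Data.Product using (Σ; ∃-syntax; _×_; _,_)
open import Data.Sum using (_⊎_; inj₁; inj₂) renaming ([_,_] to either)
open import Data.Empty using (⊥-elim)
open import Function using (_∘_; id; _⇔_; mk⇔; Equivalence)
open import Relation.Nullary using (¬_; Dec; yes; no)
open import Relation.Nullary.Decidable using (_×-dec_; ¬?)
open import Relation.Unary using (Decidable)
open import Relation.Binary.PropositionalEquality using (_≡_; refl; sym; trans; cong; cong₂; subst; subst₂; module ≡-Reasoning)

private
  variable
    A B : Set
    m n : ℕ

applyUpTo-+ : ∀ (f : ℕ → A) m k → applyUpTo f (m + k) ≡ applyUpTo f m ++ applyUpTo (f ∘ (m +_)) k
applyUpTo-+ f zero    k = refl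
applyUpTo-+ f (suc m) k = cong (f 0 ∷_) (applyUpTo-+ (f ∘ suc) m k)

upTo-split : m ≤ n → upTo n ≡ upTo m ++ applyUpTo (m +_) (n ∸ m)
upTo-split {m} {n} m≤n = trans (cong upTo (sym (m+[n∸m]≡n m≤n))) (applyUpTo-+ id m (n ∸ m))

applyUpTo-cong : ∀ {f g : ℕ → A} → (∀ k → f k ≡ g k) → ∀ n → applyUpTo f n ≡ applyUpTo g n
applyUpTo-cong f≗g zero    = refl
applyUpTo-cong f≗g (suc n) = cong₂ _∷_ (f≗g 0) (applyUpTo-cong (f≗g ∘ suc) n)

applyUpTo-between : m ≤ n → All (λ x → m ≤ x × x < n) (applyUpTo (m +_) (n ∸ m))
applyUpTo-between {m} {n} m≤n = applyUpTo⁺₁ (m +_) (n ∸ m) λ {k} k<n∸m →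
  m≤m+n m k , subst (m + k <_) (m+[n∸m]≡n m≤n) (+-monoʳ-< m k<n∸m)

applyUpTo-downFrom : ∀ n → applyUpTo (λ k → n ∸ suc k) n ≡ downFrom n
applyUpTo-downFrom zero    = refl
applyUpTo-downFrom (suc n) = cong (n ∷_) (applyUpTo-downFrom n)

map-∸suc-upTo-↭ : ∀ n → map (λ k → n ∸ suc k) (upTo n) ↭ upTo n
map-∸suc-upTo-↭ n = ↭-trans (↭-reflexive eq) (↭-reverse (upTo n))
  where
  eq : map (λ k → n ∸ suc k) (upTo n) ≡ reverse (upTo n)
  eq = trans (map-upTo _ n) (trans (applyUpTo-downFrom n) (sym (reverse-upTo n)))

module _ {P : A → Set} (P? : Decidable P) where

  filter-map : ∀ (g : B → A) xs → filter P? (map g xs) ≡ map g (filter (P? ∘ g) xs)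
  filter-map g []       = refl
  filter-map g (x ∷ xs) with P? (g x)
  ... | yes _ = cong (g x ∷_) (filter-map g xs)
  ... | no  _ = filter-map g xs

  filter-concatMap : ∀ (f : B → List A) xs → filter P? (concatMap f xs) ≡ concatMap (filter P? ∘ f) xs
  filter-concatMap f []       = refl
  filter-concatMap f (x ∷ xs) = trans (filter-++ P? (f x) (concatMap f xs)) (cong (filter P? (f x) ++_) (filter-concatMap f xs))

  filter-≐-local : ∀ {Q : A → Set} (Q? : Decidable Q) → ∀ {xs} → All (λ x → P x ⇔ Q x) xs → filter P? xs ≡ filter Q? xs
  filter-≐-local Q? {[]}     []                = refl
  filter-≐-local Q? {x ∷ xs} (P⇔Q ∷ P⇔Qs) with P? x
  ... | yes p = trans (cong (x ∷_) (filter-≐-local Q? P⇔Qs)) (sym (filter-accept Q? (Equivalence.to P⇔Q p)))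
  ... | no ¬p = trans (filter-≐-local Q? P⇔Qs) (sym (filter-reject Q? (¬p ∘ Equivalence.from P⇔Q)))

  concatMap-filter : ∀ {f g : A → List B} → (∀ {x} → P x → f x ≡ g x) → (∀ {x} → ¬ P x → f x ≡ []) →
                     ∀ xs → concatMap f xs ≡ concatMap g (filter P? xs)
  concatMap-filter f≡g f≡[] []       = refl
  concatMap-filter {f = f} f≡g f≡[] (x ∷ xs) with P? x
  ... | yes p = cong₂ _++_ (f≡g p) (concatMap-filter f≡g f≡[] xs)
  ... | no ¬p = trans (cong (_++ concatMap f xs) (f≡[] ¬p)) (concatMap-filter f≡g f≡[] xs)

concatMap⁺ : ∀ (f : A → List B) {xs ys} → xs ↭ ys → concatMap f xs ↭ concatMap f ys
concatMap⁺ f Perm.refl        = ↭-refl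
concatMap⁺ f (prep x p)       = ++⁺ˡ (f x) (concatMap⁺ f p)
concatMap⁺ f (swap x y p)     = ↭-trans (shifts (f x) (f y)) (++⁺ˡ (f y) (++⁺ˡ (f x) (concatMap⁺ f p)))
concatMap⁺ f (Perm.trans p q) = ↭-trans (concatMap⁺ f p) (concatMap⁺ f q)

concatMap-↭ : ∀ {f g : A → List B} {xs} → All (λ x → f x ↭ g x) xs → concatMap f xs ↭ concatMap g xs
concatMap-↭ []       = ↭-refl
concatMap-↭ (p ∷ ps) = ++⁺ p (concatMap-↭ ps)

-- Ranks in a decidable subset of ℕ

module _ {P : ℕ → Set} (P? : Decidable P) where

  rank : ℕ → ℕ
  rank m = length (filter P? (upTo m))

  filter-upTo-suc-accept : P m → filter P? (upTo (suc m)) ≡ filter P? (upTo m) ++ [ m ]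
  filter-upTo-suc-accept {m} p = begin
    filter P? (upTo (suc m))                    ≡⟨ cong (filter P?) (sym (upTo-∷ʳ m)) ⟩
    filter P? (upTo m ++ [ m ])                 ≡⟨ filter-++ P? (upTo m) [ m ] ⟩
    filter P? (upTo m) ++ filter P? [ m ]       ≡⟨ cong (filter P? (upTo m) ++_) (filter-accept P? p) ⟩
    filter P? (upTo m) ++ [ m ]                 ∎
    where open ≡-Reasoning

  filter-upTo-suc-reject : ¬ P m → filter P? (upTo (suc m)) ≡ filter P? (upTo m)
  filter-upTo-suc-reject {m} ¬p = begin
    filter P? (upTo (suc m))                    ≡⟨ cong (filter P?) (sym (upTo-∷ʳ m)) ⟩
    filter P? (upTo m ++ [ m ])                 ≡⟨ filter-++ P? (upTo m) [ m ] ⟩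
    filter P? (upTo m) ++ filter P? [ m ]       ≡⟨ cong (filter P? (upTo m) ++_) (filter-reject P? ¬p) ⟩
    filter P? (upTo m) ++ []                    ≡⟨ ++-identityʳ _ ⟩
    filter P? (upTo m)                          ∎
    where open ≡-Reasoning

  rank-suc-accept : P m → rank (suc m) ≡ suc (rank m)
  rank-suc-accept {m} p = trans (cong length (filter-upTo-suc-accept p))
                                (trans (length-++ (filter P? (upTo m))) (+-comm (rank m) 1))

  map-rank-filter-upTo : ∀ m → map rank (filter P? (upTo m)) ≡ upTo (rank m)
  map-rank-filter-upTo zero = refl
  map-rank-filter-upTo (suc m) with P? m
  ... | yes p = begin
    map rank (filter P? (upTo (suc m)))           ≡⟨ cong (map rank) (filter-upTo-suc-accept p) ⟩
    map rank (filter P? (upTo m) ++ [ m ])        ≡⟨ map-++ rank (filter P? (upTo m)) [ m ] ⟩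
    map rank (filter P? (upTo m)) ++ [ rank m ]   ≡⟨ cong (_++ [ rank m ]) (map-rank-filter-upTo m) ⟩
    upTo (rank m) ++ [ rank m ]                   ≡⟨ upTo-∷ʳ (rank m) ⟩
    upTo (suc (rank m))                           ≡⟨ cong upTo (sym (rank-suc-accept p)) ⟩
    upTo (rank (suc m))                           ∎
    where open ≡-Reasoning
  ... | no ¬p = begin
    map rank (filter P? (upTo (suc m)))           ≡⟨ cong (map rank) (filter-upTo-suc-reject ¬p) ⟩
    map rank (filter P? (upTo m))                 ≡⟨ map-rank-filter-upTo m ⟩
    upTo (rank m)                                 ≡⟨ cong (upTo ∘ length) (sym (filter-upTo-suc-reject ¬p)) ⟩
    upTo (rank (suc m))                           ∎
    where open ≡-Reasoning

  rank-+ : ∀ m k → rank (m + k) ≡ rank m + length (filter P? (applyUpTo (m +_) k))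
  rank-+ m k = begin
    rank (m + k)                                                  ≡⟨ cong (length ∘ filter P?) (applyUpTo-+ id m k) ⟩
    length (filter P? (upTo m ++ applyUpTo (m +_) k))             ≡⟨ cong length (filter-++ P? (upTo m) _) ⟩
    length (filter P? (upTo m) ++ filter P? (applyUpTo (m +_) k)) ≡⟨ length-++ (filter P? (upTo m)) ⟩
    rank m + length (filter P? (applyUpTo (m +_) k))              ∎
    where open ≡-Reasoning

  rank-split : m ≤ n → rank n ≡ rank m + length (filter P? (applyUpTo (m +_) (n ∸ m)))
  rank-split {m} {n} m≤n = trans (cong rank (sym (m+[n∸m]≡n m≤n))) (rank-+ m (n ∸ m))

  rank-+-all : ∀ m k → All P (applyUpTo (m +_) k) → rank (m + k) ≡ rank m + k
  rank-+-all m k all = begin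
    rank (m + k)                                      ≡⟨ rank-+ m k ⟩
    rank m + length (filter P? (applyUpTo (m +_) k))  ≡⟨ cong (λ xs → rank m + length xs) (filter-all P? all) ⟩
    rank m + length (applyUpTo (m +_) k)              ≡⟨ cong (rank m +_) (length-applyUpTo (m +_) k) ⟩
    rank m + k                                        ∎
    where open ≡-Reasoning

lookup-∷ʳ-inject₁ : ∀ (e : Vec A n) x i → lookup (e ∷ʳ x) (inject₁ i) ≡ lookup e i
lookup-∷ʳ-inject₁ (y ∷ e) x fzero    = refl
lookup-∷ʳ-inject₁ (y ∷ e) x (fsuc i) = lookup-∷ʳ-inject₁ e x i

lookup-∷ʳ-fromℕ : ∀ (e : Vec A n) x → lookup (e ∷ʳ x) (fromℕ n) ≡ x
lookup-∷ʳ-fromℕ []      x = refl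
lookup-∷ʳ-fromℕ (y ∷ e) x = lookup-∷ʳ-fromℕ e x

inject₁-mono : ∀ {i j : Fin n} → toℕ i < toℕ j → toℕ (inject₁ i) < toℕ (inject₁ j)
inject₁-mono {i = i} {j} = subst₂ _<_ (sym (toℕ-inject₁ i)) (sym (toℕ-inject₁ j))

inject₁-mono⁻¹ : ∀ {i j : Fin n} → toℕ (inject₁ i) < toℕ (inject₁ j) → toℕ i < toℕ j
inject₁-mono⁻¹ {i = i} {j} = subst₂ _<_ (toℕ-inject₁ i) (toℕ-inject₁ j)

inject₁<fromℕ : ∀ (i : Fin n) → toℕ (inject₁ i) < toℕ (fromℕ n)
inject₁<fromℕ {n} i = subst₂ _<_ (sym (toℕ-inject₁ i)) (sym (toℕ-fromℕ n)) (toℕ<n i)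

fromℕ≮ : ∀ (j : Fin (suc n)) → ¬ toℕ (fromℕ n) < toℕ j
fromℕ≮ j fromℕ<j = <⇒≱ fromℕ<j (≤fromℕ j)

max : Vec ℕ n → ℕ
max []      = 0
max (x ∷ e) = x ⊔ max e

lookup≤max : ∀ (e : Vec ℕ n) i → lookup e i ≤ max e
lookup≤max (x ∷ e) fzero    = m≤m⊔n x (max e)
lookup≤max (x ∷ e) (fsuc i) = m≤n⇒m≤o⊔n x (lookup≤max e i)

<max⇒<lookup : ∀ (e : Vec ℕ n) {y} → y < max e → ∃[ i ] y < lookup e i
<max⇒<lookup (x ∷ e) {y} y<max with ≤-total x (max e)
... | inj₁ x≤max = let i , y<eᵢ = <max⇒<lookup e (subst (y <_) (m≤n⇒m⊔n≡n x≤max) y<max) in fsuc i , y<eᵢ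
... | inj₂ max≤x = fzero , subst (y <_) (m≥n⇒m⊔n≡m max≤x) y<max

max-∷ʳ : ∀ (e : Vec ℕ n) y → max (e ∷ʳ y) ≡ max e ⊔ y
max-∷ʳ []      y = ⊔-identityʳ y
max-∷ʳ (x ∷ e) y = trans (cong (x ⊔_) (max-∷ʳ e y)) (sym (⊔-assoc x (max e) y))

max-∷ʳ-≤ : ∀ (e : Vec ℕ n) {y} → y ≤ max e → max (e ∷ʳ y) ≡ max e
max-∷ʳ-≤ e {y} y≤max = trans (max-∷ʳ e y) (m≥n⇒m⊔n≡m y≤max)

max-∷ʳ-≥ : ∀ (e : Vec ℕ n) {y} → max e ≤ y → max (e ∷ʳ y) ≡ y
max-∷ʳ-≥ e {y} max≤y = trans (max-∷ʳ e y) (m≤n⇒m⊔n≡n max≤y)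

max-invSeqs : ∀ n → All (λ e → max e ≤ n) (invSeqs n)
max-invSeqs zero    = z≤n ∷ []
max-invSeqs (suc n) = concat⁺ (All.map⁺ (All.map extensions-bounded (max-invSeqs n)))
  where
  extensions-bounded : ∀ {e} → max e ≤ n → All (λ e′ → max e′ ≤ suc n) (map (e ∷ʳ_) (upTo (suc n)))
  extensions-bounded {e} max≤n = All.map⁺ (applyUpTo⁺₁ id (suc n) λ {x} x<1+n →
    subst (_≤ suc n) (sym (max-∷ʳ e x)) (⊔-lub (m≤n⇒m≤1+n max≤n) (<⇒≤ x<1+n)))

-- The generating tree

Label : Set
Label = ℕ × ℕ

children : ℕ → Label → List Label
children n (M , s) = map (M ,_) (upTo s) ++ applyUpTo (λ k → M + k , s + k) (suc n ∸ M)

treeLevel : ℕ → List Label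
treeLevel zero    = [ 0 , 0 ]
treeLevel (suc n) = concatMap (children n) (treeLevel n)

-- Occurrences of a pattern i < j < k, R eᵢ eⱼ eₖ

subst₃ : ∀ (R : ℕ → ℕ → ℕ → Set) {a a′ b b′ c c′} →
         a ≡ a′ → b ≡ b′ → c ≡ c′ → R a b c → R a′ b′ c′
subst₃ R refl refl refl r = r

module Pattern (R : ℕ → ℕ → ℕ → Set) (R? : ∀ a b c → Dec (R a b c)) where

  Occurs : Vec ℕ n → Set
  Occurs {n} e = Σ (Fin n) λ i → Σ (Fin n) λ j → Σ (Fin n) λ k →
    (toℕ i < toℕ j) × (toℕ j < toℕ k) × R (lookup e i) (lookup e j) (lookup e k)

  -- Occurs₂ e x and Occurs₁ e y x: occurrences in e ∷ʳ x, resp. e ∷ʳ y ∷ʳ x,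
  -- using two, resp. one, entries of e.
  Occurs₂ : Vec ℕ n → ℕ → Set
  Occurs₂ {n} e x = Σ (Fin n) λ i → Σ (Fin n) λ j → (toℕ i < toℕ j) × R (lookup e i) (lookup e j) x

  Occurs₁ : Vec ℕ n → ℕ → ℕ → Set
  Occurs₁ {n} e y x = Σ (Fin n) λ i → R (lookup e i) y x

  Avoids : Vec ℕ n → Set
  Avoids e = ¬ Occurs e

  Active : Vec ℕ n → ℕ → Set
  Active e x = ¬ Occurs₂ e x

  avoids? : (e : Vec ℕ n) → Dec (Avoids e)
  avoids? e = ¬? (any? λ i → any? λ j → any? λ k →
    (toℕ i <? toℕ j) ×-dec (toℕ j <? toℕ k) ×-dec R? (lookup e i) (lookup e j) (lookup e k))

  active? : (e : Vec ℕ n) → Decidable (Active e)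
  active? e x = ¬? (any? λ i → any? λ j → (toℕ i <? toℕ j) ×-dec R? (lookup e i) (lookup e j) x)

  Occurs-∷ʳ⁻ : ∀ (e : Vec ℕ n) x → Occurs (e ∷ʳ x) → Occurs e ⊎ Occurs₂ e x
  Occurs-∷ʳ⁻ e x (i , j , k , i<j , j<k , r) with view i | view j | view k
  ... | ‵fromℕ      | _           | _           = ⊥-elim (fromℕ≮ j i<j)
  ... | ‵inject₁ _  | ‵fromℕ      | _           = ⊥-elim (fromℕ≮ k j<k)
  ... | ‵inject₁ i′ | ‵inject₁ j′ | ‵fromℕ      = inj₂ (i′ , j′ , inject₁-mono⁻¹ i<j ,
    subst₃ R (lookup-∷ʳ-inject₁ e x i′) (lookup-∷ʳ-inject₁ e x j′) (lookup-∷ʳ-fromℕ e x) r)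
  ... | ‵inject₁ i′ | ‵inject₁ j′ | ‵inject₁ k′ = inj₁ (i′ , j′ , k′ , inject₁-mono⁻¹ i<j , inject₁-mono⁻¹ j<k ,
    subst₃ R (lookup-∷ʳ-inject₁ e x i′) (lookup-∷ʳ-inject₁ e x j′) (lookup-∷ʳ-inject₁ e x k′) r)

  Occurs-∷ʳ⁺ˡ : ∀ (e : Vec ℕ n) x → Occurs e → Occurs (e ∷ʳ x)
  Occurs-∷ʳ⁺ˡ e x (i , j , k , i<j , j<k , r) =
    inject₁ i , inject₁ j , inject₁ k , inject₁-mono i<j , inject₁-mono j<k ,
    subst₃ R (sym (lookup-∷ʳ-inject₁ e x i)) (sym (lookup-∷ʳ-inject₁ e x j)) (sym (lookup-∷ʳ-inject₁ e x k)) r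

  Occurs-∷ʳ⁺ʳ : ∀ (e : Vec ℕ n) x → Occurs₂ e x → Occurs (e ∷ʳ x)
  Occurs-∷ʳ⁺ʳ e x (i , j , i<j , r) =
    inject₁ i , inject₁ j , fromℕ _ , inject₁-mono i<j , inject₁<fromℕ j ,
    subst₃ R (sym (lookup-∷ʳ-inject₁ e x i)) (sym (lookup-∷ʳ-inject₁ e x j)) (sym (lookup-∷ʳ-fromℕ e x)) r

  Occurs₂-∷ʳ⁻ : ∀ (e : Vec ℕ n) y x → Occurs₂ (e ∷ʳ y) x → Occurs₂ e x ⊎ Occurs₁ e y x
  Occurs₂-∷ʳ⁻ e y x (i , j , i<j , r) with view i | view j
  ... | ‵fromℕ      | _           = ⊥-elim (fromℕ≮ j i<j)
  ... | ‵inject₁ i′ | ‵fromℕ      = inj₂ (i′ , subst₃ R (lookup-∷ʳ-inject₁ e y i′) (lookup-∷ʳ-fromℕ e y) refl r)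
  ... | ‵inject₁ i′ | ‵inject₁ j′ = inj₁ (i′ , j′ , inject₁-mono⁻¹ i<j ,
    subst₃ R (lookup-∷ʳ-inject₁ e y i′) (lookup-∷ʳ-inject₁ e y j′) refl r)

  Occurs₂-∷ʳ⁺ˡ : ∀ (e : Vec ℕ n) y x → Occurs₂ e x → Occurs₂ (e ∷ʳ y) x
  Occurs₂-∷ʳ⁺ˡ e y x (i , j , i<j , r) = inject₁ i , inject₁ j , inject₁-mono i<j ,
    subst₃ R (sym (lookup-∷ʳ-inject₁ e y i)) (sym (lookup-∷ʳ-inject₁ e y j)) refl r

  Occurs₂-∷ʳ⁺ʳ : ∀ (e : Vec ℕ n) y x → Occurs₁ e y x → Occurs₂ (e ∷ʳ y) x
  Occurs₂-∷ʳ⁺ʳ e y x (i , r) = inject₁ i , fromℕ _ , inject₁<fromℕ i ,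
    subst₃ R (sym (lookup-∷ʳ-inject₁ e y i)) (sym (lookup-∷ʳ-fromℕ e y)) refl r

  Avoids-∷ʳ : ∀ (e : Vec ℕ n) → Avoids e → ∀ x → Avoids (e ∷ʳ x) ⇔ Active e x
  Avoids-∷ʳ e avoids x = mk⇔ (λ avoids′ → avoids′ ∘ Occurs-∷ʳ⁺ʳ e x)
                             (λ active → either avoids active ∘ Occurs-∷ʳ⁻ e x)

  ¬Avoids-∷ʳ : ∀ (e : Vec ℕ n) → ¬ Avoids e → ∀ x → ¬ Avoids (e ∷ʳ x)
  ¬Avoids-∷ʳ e ¬avoids x avoids′ = ¬avoids (avoids′ ∘ Occurs-∷ʳ⁺ˡ e x)

  Active-∷ʳ : ∀ (e : Vec ℕ n) {y x} → ¬ Occurs₁ e y x → Active (e ∷ʳ y) x ⇔ Active e x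
  Active-∷ʳ e {y} {x} ¬occ = mk⇔ (λ active′ → active′ ∘ Occurs₂-∷ʳ⁺ˡ e y x)
                                 (λ active → either active ¬occ ∘ Occurs₂-∷ʳ⁻ e y x)

  Occurs₁⇒¬Active-∷ʳ : ∀ (e : Vec ℕ n) {y x} → Occurs₁ e y x → ¬ Active (e ∷ʳ y) x
  Occurs₁⇒¬Active-∷ʳ e {y} {x} occ active′ = active′ (Occurs₂-∷ʳ⁺ʳ e y x occ)

  module GeneratingTree
    (active-above-max : ∀ {n} (e : Vec ℕ n) {x} → max e ≤ x → Active e x)
    (¬Occurs₁-above-max : ∀ {n} (e : Vec ℕ n) {y x} → max e ≤ y → x < y → ¬ Occurs₁ e y x)
    (relabel : ℕ → ℕ → ℕ)
    (map-relabel-↭ : ∀ s → map (relabel s) (upTo s) ↭ upTo s)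
    (rank-∷ʳ-below-max : ∀ {n} (e : Vec ℕ n) {y} → y < max e → Active e y →
       rank (active? (e ∷ʳ y)) (max e) ≡ relabel (rank (active? e) (max e)) (rank (active? e) y))
    where

    label : Vec ℕ n → Label
    label e = max e , rank (active? e) (max e)

    avoiders : (n : ℕ) → List (Vec ℕ n)
    avoiders n = filter avoids? (invSeqs n)

    extensions : ℕ → Vec ℕ m → List (Vec ℕ (suc m))
    extensions n e = map (e ∷ʳ_) (filter (active? e) (upTo (suc n)))

    avoiders-suc : ∀ n → avoiders (suc n) ≡ concatMap (extensions n) (avoiders n)
    avoiders-suc n = trans (filter-concatMap avoids? _ (invSeqs n))
                           (concatMap-filter avoids? extend-avoider extend-occurrer (invSeqs n))
      where
      extend-avoider : ∀ {m} {e : Vec ℕ m} → Avoids e → filter avoids? (map (e ∷ʳ_) (upTo (suc n))) ≡ extensions n e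
      extend-avoider {e = e} avoids = trans (filter-map avoids? (e ∷ʳ_) (upTo (suc n)))
        (cong (map (e ∷ʳ_)) (filter-≐-local (avoids? ∘ (e ∷ʳ_)) (active? e) (All.universal (Avoids-∷ʳ e avoids) (upTo (suc n)))))

      extend-occurrer : ∀ {m} {e : Vec ℕ m} → ¬ Avoids e → filter avoids? (map (e ∷ʳ_) (upTo (suc n))) ≡ []
      extend-occurrer {e = e} ¬avoids = filter-none avoids? (All.map⁺ (All.universal (¬Avoids-∷ʳ e ¬avoids) (upTo (suc n))))

    label-∷ʳ-below-max : ∀ (e : Vec ℕ n) {y} → y < max e → Active e y →
                         label (e ∷ʳ y) ≡ (max e , relabel (rank (active? e) (max e)) (rank (active? e) y))
    label-∷ʳ-below-max e y<max active rewrite max-∷ʳ-≤ e (<⇒≤ y<max) =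
      cong (max e ,_) (rank-∷ʳ-below-max e y<max active)

    label-∷ʳ-above-max : ∀ (e : Vec ℕ n) k → label (e ∷ʳ (max e + k)) ≡ (max e + k , rank (active? e) (max e) + k)
    label-∷ʳ-above-max e k rewrite max-∷ʳ-≥ e (m≤m+n (max e) k) = cong (max e + k ,_) (begin
      rank (active? (e ∷ʳ (max e + k))) (max e + k)  ≡⟨ cong length (filter-≐-local (active? (e ∷ʳ _)) (active? e) same-actives) ⟩
      rank (active? e) (max e + k)                   ≡⟨ rank-+-all (active? e) (max e) k all-active ⟩
      rank (active? e) (max e) + k                   ∎)
      where
      open ≡-Reasoning
      same-actives : All (λ x → Active (e ∷ʳ (max e + k)) x ⇔ Active e x) (upTo (max e + k))
      same-actives = All.map (λ x<y → Active-∷ʳ e (¬Occurs₁-above-max e (m≤m+n _ k) x<y)) (all-upTo _)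

      all-active : All (Active e) (applyUpTo (max e +_) k)
      all-active = applyUpTo⁺₂ _ k λ k′ → active-above-max e (m≤m+n _ k′)

    labels-extensions : ∀ n (e : Vec ℕ m) → max e ≤ suc n → map label (extensions n e) ↭ children n (label e)
    labels-extensions n e max≤1+n = begin
      map label (map (e ∷ʳ_) (filter (active? e) (upTo (suc n))))  ≡⟨ cong (map label ∘ map (e ∷ʳ_)) actives ⟩
      map label (map (e ∷ʳ_) (low ++ high))                       ≡⟨ sym (map-∘ (low ++ high)) ⟩
      map (label ∘ (e ∷ʳ_)) (low ++ high)                          ≡⟨ map-++ (label ∘ (e ∷ʳ_)) low high ⟩
      map (label ∘ (e ∷ʳ_)) low ++ map (label ∘ (e ∷ʳ_)) high      ↭⟨ ++⁺ lower (↭-reflexive upper) ⟩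
      children n (label e)                                         ∎
      where
      open PermutationReasoning
      M = max e
      s = rank (active? e) M
      low = filter (active? e) (upTo M)
      high = applyUpTo (M +_) (suc n ∸ M)

      actives : filter (active? e) (upTo (suc n)) ≡ low ++ high
      actives = trans (cong (filter (active? e)) (upTo-split max≤1+n))
        (trans (filter-++ (active? e) (upTo M) high)
               (cong (low ++_) (filter-all (active? e) (applyUpTo⁺₂ _ _ λ k → active-above-max e (m≤m+n M k)))))

      lower : map (label ∘ (e ∷ʳ_)) low ↭ map (M ,_) (upTo s)
      lower = begin
        map (label ∘ (e ∷ʳ_)) low                                 ≡⟨ map-cong-local relabelled ⟩
        map ((M ,_) ∘ relabel s ∘ rank (active? e)) low            ≡⟨ map-∘ low ⟩
        map (M ,_) (map (relabel s ∘ rank (active? e)) low)        ≡⟨ cong (map (M ,_)) (map-∘ low) ⟩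
        map (M ,_) (map (relabel s) (map (rank (active? e)) low))  ≡⟨ cong (map (M ,_) ∘ map (relabel s)) ranks ⟩
        map (M ,_) (map (relabel s) (upTo s))                      ↭⟨ Perm.map⁺ (M ,_) (map-relabel-↭ s) ⟩
        map (M ,_) (upTo s)                                        ∎
        where
        relabelled : All (λ y → label (e ∷ʳ y) ≡ (M , relabel s (rank (active? e) y))) low
        relabelled = All.map (λ (y<M , active) → label-∷ʳ-below-max e y<M active)
                             (All.zip (filter⁺ (active? e) (all-upTo M) , all-filter (active? e) (upTo M)))

        ranks : map (rank (active? e)) low ≡ upTo s
        ranks = map-rank-filter-upTo (active? e) M

      upper : map (label ∘ (e ∷ʳ_)) high ≡ applyUpTo (λ k → M + k , s + k) (suc n ∸ M)
      upper = trans (map-applyUpTo (M +_) (label ∘ (e ∷ʳ_)) (suc n ∸ M))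
                    (applyUpTo-cong (label-∷ʳ-above-max e) (suc n ∸ M))

    labels-avoiders : ∀ n → map label (avoiders n) ↭ treeLevel n
    labels-avoiders zero    = ↭-reflexive (cong (map label) (filter-accept avoids? {[]} {[]} λ { (() , _) }))
    labels-avoiders (suc n) = begin
      map label (avoiders (suc n))                       ≡⟨ cong (map label) (avoiders-suc n) ⟩
      map label (concatMap (extensions n) (avoiders n))  ≡⟨ map-concatMap label (extensions n) (avoiders n) ⟩
      concatMap (map label ∘ extensions n) (avoiders n)  ↭⟨ concatMap-↭ (All.map (labels-extensions n _ ∘ m≤n⇒m≤1+n) bounded) ⟩
      concatMap (children n ∘ label) (avoiders n)        ≡⟨ sym (concatMap-map (children n) label (avoiders n)) ⟩
      concatMap (children n) (map label (avoiders n))    ↭⟨ concatMap⁺ (children n) (labels-avoiders n) ⟩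
      treeLevel (suc n)                                  ∎
      where
      open PermutationReasoning
      bounded : All (λ e → max e ≤ n) (avoiders n)
      bounded = filter⁺ avoids? (max-invSeqs n)

    length-avoiders : ∀ n → length (avoiders n) ≡ length (treeLevel n)
    length-avoiders n = trans (sym (length-map label (avoiders n))) (↭-length (labels-avoiders n))

-- The two patterns

module Avoiding₁ where

  R₁ : ℕ → ℕ → ℕ → Set
  R₁ a b c = b < a × c ≤ b

  R₁? : ∀ a b c → Dec (R₁ a b c)
  R₁? a b c = (b <? a) ×-dec (c ≤? b)

  open Pattern R₁ R₁?

  active-above-max : ∀ (e : Vec ℕ n) {x} → max e ≤ x → Active e x
  active-above-max e max≤x (i , j , _ , eⱼ<eᵢ , x≤eⱼ) =
    <⇒≱ (≤-<-trans x≤eⱼ eⱼ<eᵢ) (≤-trans (lookup≤max e i) max≤x)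

  ¬Occurs₁-above-max : ∀ (e : Vec ℕ n) {y x} → max e ≤ y → x < y → ¬ Occurs₁ e y x
  ¬Occurs₁-above-max e max≤y _ (i , y<eᵢ , _) = <⇒≱ y<eᵢ (≤-trans (lookup≤max e i) max≤y)

  rank-∷ʳ-below-max : ∀ (e : Vec ℕ n) {y} → y < max e → Active e y →
    rank (active? (e ∷ʳ y)) (max e) ≡ rank (active? e) (max e) ∸ suc (rank (active? e) y)
  rank-∷ʳ-below-max e {y} y<M active = begin
    rank active′? M                                         ≡⟨ rank-split active′? y<M ⟩
    rank active′? (suc y) + length (filter active′? above)  ≡⟨ cong₂ _+_ none-below same-above ⟩
    rest                                                    ≡⟨ sym (m+n∸m≡n (r (suc y)) rest) ⟩
    r (suc y) + rest ∸ r (suc y)                            ≡⟨ cong (_∸ r (suc y)) (sym (rank-split (active? e) y<M)) ⟩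
    r M ∸ r (suc y)                                         ≡⟨ cong (r M ∸_) (rank-suc-accept (active? e) active) ⟩
    r M ∸ suc (r y)                                         ∎
    where
    open ≡-Reasoning
    M = max e
    r = rank (active? e)
    active′? = active? (e ∷ʳ y)
    above = applyUpTo (suc y +_) (M ∸ suc y)
    rest = length (filter (active? e) above)

    none-below : rank active′? (suc y) ≡ 0
    none-below = cong length (filter-none active′? (All.map (λ x<1+y →
      let i , y<eᵢ = <max⇒<lookup e y<M in Occurs₁⇒¬Active-∷ʳ e (i , y<eᵢ , s≤s⁻¹ x<1+y)) (all-upTo (suc y))))

    same-above : length (filter active′? above) ≡ length (filter (active? e) above)
    same-above = cong length (filter-≐-local active′? (active? e)
      (All.map (λ (y<x , _) → Active-∷ʳ e λ (_ , _ , x≤y) → <⇒≱ y<x x≤y) (applyUpTo-between y<M)))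

  open GeneratingTree active-above-max ¬Occurs₁-above-max
    (λ s k → s ∸ suc k) map-∸suc-upTo-↭ rank-∷ʳ-below-max public

module Avoiding₂ where

  R₂ : ℕ → ℕ → ℕ → Set
  R₂ a b c = b ≤ c × c < a

  R₂? : ∀ a b c → Dec (R₂ a b c)
  R₂? a b c = (b ≤? c) ×-dec (c <? a)

  open Pattern R₂ R₂?

  active-above-max : ∀ (e : Vec ℕ n) {x} → max e ≤ x → Active e x
  active-above-max e max≤x (i , j , _ , _ , x<eᵢ) = <⇒≱ x<eᵢ (≤-trans (lookup≤max e i) max≤x)

  ¬Occurs₁-above-max : ∀ (e : Vec ℕ n) {y x} → max e ≤ y → x < y → ¬ Occurs₁ e y x
  ¬Occurs₁-above-max e _ x<y (_ , y≤x , _) = <⇒≱ x<y y≤x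

  rank-∷ʳ-below-max : ∀ (e : Vec ℕ n) {y} → y < max e → Active e y →
    rank (active? (e ∷ʳ y)) (max e) ≡ rank (active? e) y
  rank-∷ʳ-below-max e {y} y<M _ = begin
    rank active′? M                                    ≡⟨ rank-split active′? (<⇒≤ y<M) ⟩
    rank active′? y + length (filter active′? above)   ≡⟨ cong₂ _+_ same-below none-above ⟩
    rank (active? e) y + 0                             ≡⟨ +-identityʳ _ ⟩
    rank (active? e) y                                 ∎
    where
    open ≡-Reasoning
    M = max e
    active′? = active? (e ∷ʳ y)
    above = applyUpTo (y +_) (M ∸ y)

    same-below : rank active′? y ≡ rank (active? e) y
    same-below = cong length (filter-≐-local active′? (active? e)
      (All.map (λ x<y → Active-∷ʳ e λ (_ , y≤x , _) → <⇒≱ x<y y≤x) (all-upTo y)))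

    none-above : length (filter active′? above) ≡ 0
    none-above = cong length (filter-none active′? (All.map (λ (y≤x , x<M) →
      let i , x<eᵢ = <max⇒<lookup e x<M in Occurs₁⇒¬Active-∷ʳ e (i , y≤x , x<eᵢ)) (applyUpTo-between (<⇒≤ y<M))))

  open GeneratingTree active-above-max ¬Occurs₁-above-max
    (λ _ k → k) (λ s → ↭-reflexive (map-id (upTo s))) rank-∷ʳ-below-max public

mainTheorem17 : (n : ℕ) → 1 ≤ n → count₁ n ≡ count₂ n
mainTheorem17 n _ = trans (Avoiding₁.length-avoiders n) (sym (Avoiding₂.length-avoiders n))
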